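{- If $G$ is a simple oriented hypergraph with vertices $v_1,\dots,v_n$, then the $(i,j)$-entry of $L_G$ is $\ell_{ij}=\widetilde{w}(v_i,v_j;1)-2w^+(v_i,v_j;1)$.
   Context: An oriented hypergraph $G=(V,E,\mathcal{I},\sigma)$ consists of disjoint finite sets $V$, $E$, an incidence function $\iota:V\times E\to\mathbb{Z}_{\ge0}$, incidences $(v,e,k)$ with $1\le k\le\iota(v,e)$, and $\sigma:\mathcal{I}\to\{+1,-1\}$. Simple means $\iota(v,e)\le1$; write $(v,e)$ for $(v,e,1)$. For simple $G$: $sgn_e(v,w)=-\sigma(v,e)\sigma(w,e)$ if $(v,e),(w,e)$ are distinct incidences and $0$ otherwise; $A_G=[a_{ij}]$, $a_{ij}=\sum_e sgn_e(v_i,v_j)$; $D_G=\mathrm{diag}(\deg v_1,\dots,\deg v_n)$ with $\deg v$ the number of incidences containing $v$; $L_G=D_G-A_G$. A walk is a sequence $W=a_0,i_1,a_1,\dots,i_n,a_n$ where $a_0,\dots,a_n$ alternate between vertices and edges, each $i_h$ is an incidence containing $a_{h-1}$ and $a_h$, and $i_{2h-1}\ne i_{2h}$ for all $h$ with $2h\le n$; its length is $n/2$ and its sign is $(-1)^{\lfloor n/2\rfloor}\prod_{h=1}^n\sigma(i_h)$. A weak walk is defined the same way without the condition $i_{2h-1}\ne i_{2h}$. $w^+(a,b;k)$ is the number of positive walks of length $k$ from $a$ to $b$, and $\widetilde{w}(a,b;k)$ is the number of weak walks of length $k$ from $a$ to $b$. -}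

module Defs where

open import Data.Nat as ℕ using (ℕ; zero; suc; _≤_; _≡ᵇ_)
open import Data.Integer as ℤ using (ℤ; _◃_)
open import Data.Sign as Sign using (Sign; opposite)
open import Data.Fin using (Fin; toℕ)
open import Data.Fin.Properties using (_≟_)
open import Data.Bool using (Bool; true; false; _∧_; not; T; if_then_else_)
open import Data.Maybe using (Maybe; just; nothing)
open import Relation.Nullary.Decidable using (⌊_⌋)
open import Relation.Binary.PropositionalEquality using (_≡_)
open import Data.Product using (Σ)

-- Finite oriented hypergraph with vertex set Fin nV and edge set Fin nE.
-- ι v e is the incidence multiplicity; the incidences are the triples
-- (v , e , k) with k : Fin (ι v e) (k = 0 stands for the paper's k = 1),
-- and σ assigns a sign to each incidence.
record OHG : Set where
  field
    nV : ℕ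
    nE : ℕ
    ι  : Fin nV → Fin nE → ℕ
    σ  : (v : Fin nV) (e : Fin nE) → Fin (ι v e) → Sign
open OHG public

Simple : OHG → Set
Simple G = ∀ v e → ι G v e ≤ 1

sumℕ : (m : ℕ) → (Fin m → ℕ) → ℕ
sumℕ zero    f = 0
sumℕ (suc m) f = f Fin.zero ℕ.+ sumℕ m (λ i → f (Fin.suc i))
  where import Data.Fin as Fin

sumℤ : (m : ℕ) → (Fin m → ℤ) → ℤ
sumℤ zero    f = ℤ.+ 0
sumℤ (suc m) f = f Fin.zero ℤ.+ sumℤ m (λ i → f (Fin.suc i))
  where import Data.Fin as Fin

firstSign : (k : ℕ) → (Fin k → Sign) → Maybe Sign
firstSign zero    s = nothing
firstSign (suc k) s = just (s Fin.zero)
  where import Data.Fin as Fin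

-- sgn_e(v,w) = -σ(v,e)σ(w,e) if (v,e),(w,e) are distinct incidences, 0 otherwise
sgn : (G : OHG) → Fin (nE G) → Fin (nV G) → Fin (nV G) → ℤ
sgn G e v w with ⌊ v ≟ w ⌋ | firstSign (ι G v e) (σ G v e) | firstSign (ι G w e) (σ G w e)
... | false | just s | just t = opposite (s Sign.* t) ◃ 1
... | _     | _      | _      = ℤ.+ 0

adjacency : (G : OHG) → Fin (nV G) → Fin (nV G) → ℤ
adjacency G v w = sumℤ (nE G) (λ e → sgn G e v w)

degree : (G : OHG) → Fin (nV G) → ℕ
degree G v = sumℕ (nE G) (λ e → ι G v e)

degreeMatrix : (G : OHG) → Fin (nV G) → Fin (nV G) → ℤ
degreeMatrix G v w = if ⌊ v ≟ w ⌋ then ℤ.+ (degree G v) else ℤ.+ 0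

laplacian : (G : OHG) → Fin (nV G) → Fin (nV G) → ℤ
laplacian G v w = degreeMatrix G v w ℤ.- adjacency G v w

sameInc : (G : OHG) (e : Fin (nE G)) (u w : Fin (nV G)) →
          Fin (ι G u e) → Fin (ι G w e) → Bool
sameInc G e u w k₁ k₂ = ⌊ u ≟ w ⌋ ∧ (toℕ k₁ ≡ᵇ toℕ k₂)

-- Weak walks from vertex u to vertex z of length l (l = number of
-- vertex-edge-vertex steps, i.e. the sequence has 2l incidences).
-- step e k₁ k₂ W : u ,(u,e,k₁), e ,(w,e,k₂), w, followed by W.
data WeakWalk (G : OHG) : Fin (nV G) → Fin (nV G) → ℕ → Set where
  nil  : ∀ {u} → WeakWalk G u u 0
  step : ∀ {u w z l} (e : Fin (nE G)) (k₁ : Fin (ι G u e)) (k₂ : Fin (ι G w e)) →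
         WeakWalk G w z l → WeakWalk G u z (suc l)

data Walk (G : OHG) : Fin (nV G) → Fin (nV G) → ℕ → Set where
  nil  : ∀ {u} → Walk G u u 0
  step : ∀ {u w z l} (e : Fin (nE G)) (k₁ : Fin (ι G u e)) (k₂ : Fin (ι G w e)) →
         T (not (sameInc G e u w k₁ k₂)) →
         Walk G w z l → Walk G u z (suc l)

-- sign of a vertex-to-vertex walk: (-1)^{floor(n/2)} ∏ σ(i_h) with n = 2l,
-- i.e. the product over steps of -σ(i_{2h-1})σ(i_{2h}).
walkSign : ∀ {G u z l} → Walk G u z l → Sign
walkSign nil = Sign.+
walkSign {G} (step {u} {w} e k₁ k₂ _ W) =
  opposite (σ G u e k₁ Sign.* σ G w e k₂) Sign.* walkSign W

PosWalk : (G : OHG) → Fin (nV G) → Fin (nV G) → ℕ → Set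
PosWalk G u z l = Σ (Walk G u z l) (λ W → walkSign W ≡ Sign.+)

module Submission where

-- The proof is edge by edge.  Both sides are sums over the edges e:
--   * L_G(v,w) = Σ_e ([v = w] ι(v,e) - sgn_e(v,w))  (laplacian-edgeSum);
--   * a weak walk of length 1 is an edge together with an incidence of v and
--     an incidence of w on it, so w̃(v,w;1) = Σ_e ι(v,e) ι(w,e);
--   * a positive walk of length 1 is an edge together with a pair of distinct
--     incidences of v and w on it giving a positive step, so
--     w⁺(v,w;1) = Σ_e p_e(v,w) with p_e the number of such pairs.
-- In a simple hypergraph ι(v,e) ∈ {0,1}, and a finite case analysis shows that
-- each edge contributes equally to both sides:
--   [v = w] ι(v,e) - sgn_e(v,w) = ι(v,e) ι(w,e) - 2 p_e(v,w)
-- (loop-contribution for v = w, link-contribution for v ≠ w).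

open import Defs
open import Data.Nat using (ℕ)
open import Data.Integer using (_-_; _*_; +_)
open import Data.Fin using (Fin)
open import Function.Bundles using (_↔_)
open import Relation.Binary.PropositionalEquality using (_≡_)

open import Data.Nat as ℕ using (zero; suc; _≤_; z≤n; s≤s)
open import Data.Integer using (ℤ; _+_; _◃_)
import Data.Integer.Properties as ℤP
open import Data.Integer.Tactic.RingSolver using (solve-∀)
open import Data.Sign as Sign using (Sign; opposite)
import Data.Fin as Fin
open import Data.Fin using (toℕ)
open import Data.Fin.Patterns using (0F)
open import Data.Fin.Properties using (_≟_; +↔⊎; *↔×)
open import Data.Fin.Permutation using (↔⇒≡)
open import Data.Bool using (Bool; true; false; _∧_; not; T; if_then_else_)
open import Data.Maybe using (Maybe; just; nothing)
open import Data.Product using (Σ; _×_; _,_)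
open import Data.Sum using (_⊎_; inj₁; inj₂)
open import Data.Sum.Function.Propositional using (_⊎-↔_)
open import Data.Empty using (⊥; ⊥-elim)
open import Data.Unit using (tt)
open import Relation.Nullary using (yes; no)
open import Relation.Nullary.Decidable using (⌊_⌋)
open import Relation.Binary.PropositionalEquality using (refl; sym; cong; cong₂; module ≡-Reasoning)
open import Function.Bundles using (mk↔ₛ′)
open import Function.Properties.Inverse using (↔-trans; ↔-sym)

open ≡-Reasoning

sumℤ-cong : ∀ m {f h : Fin m → ℤ} → (∀ e → f e ≡ h e) → sumℤ m f ≡ sumℤ m h
sumℤ-cong zero    f≡h = refl
sumℤ-cong (suc m) f≡h = cong₂ _+_ (f≡h 0F) (sumℤ-cong m (λ e → f≡h (Fin.suc e)))

sumℤ-zero : ∀ m → sumℤ m (λ _ → + 0) ≡ + 0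
sumℤ-zero zero    = refl
sumℤ-zero (suc m) = cong (_+_ (+ 0)) (sumℤ-zero m)

sumℤ-- : ∀ m (f h : Fin m → ℤ) → sumℤ m (λ e → f e - h e) ≡ sumℤ m f - sumℤ m h
sumℤ-- zero    f h = refl
sumℤ-- (suc m) f h = begin
  (f 0F - h 0F) + sumℤ m (λ e → f (Fin.suc e) - h (Fin.suc e))
    ≡⟨ cong (_+_ (f 0F - h 0F)) (sumℤ-- m (λ e → f (Fin.suc e)) (λ e → h (Fin.suc e))) ⟩
  (f 0F - h 0F) + (sumℤ m (λ e → f (Fin.suc e)) - sumℤ m (λ e → h (Fin.suc e)))
    ≡⟨ regroup (f 0F) (h 0F) _ _ ⟩
  (f 0F + sumℤ m (λ e → f (Fin.suc e))) - (h 0F + sumℤ m (λ e → h (Fin.suc e))) ∎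
  where
  regroup : ∀ a b c d → (a - b) + (c - d) ≡ (a + c) - (b + d)
  regroup = solve-∀

sumℤ-*ˡ : ∀ m c (f : Fin m → ℤ) → sumℤ m (λ e → c * f e) ≡ c * sumℤ m f
sumℤ-*ˡ zero    c f = sym (ℤP.*-zeroʳ c)
sumℤ-*ˡ (suc m) c f = begin
  c * f 0F + sumℤ m (λ e → c * f (Fin.suc e))
    ≡⟨ cong (_+_ (c * f 0F)) (sumℤ-*ˡ m c (λ e → f (Fin.suc e))) ⟩
  c * f 0F + c * sumℤ m (λ e → f (Fin.suc e))
    ≡⟨ sym (ℤP.*-distribˡ-+ c (f 0F) _) ⟩
  c * (f 0F + sumℤ m (λ e → f (Fin.suc e))) ∎

+-sumℕ : ∀ m (f : Fin m → ℕ) → + sumℕ m f ≡ sumℤ m (λ e → + f e)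
+-sumℕ zero    f = refl
+-sumℕ (suc m) f = cong (_+_ (+ f 0F)) (+-sumℕ m (λ e → f (Fin.suc e)))

if-sumℕ : ∀ d m (f : Fin m → ℕ) →
  (if d then + sumℕ m f else + 0) ≡ sumℤ m (λ e → if d then + f e else + 0)
if-sumℕ true  m f = +-sumℕ m f
if-sumℕ false m f = sym (sumℤ-zero m)

sumℤ-counts : ∀ m (f k : Fin m → ℕ) →
  sumℤ m (λ e → + f e - + 2 * + k e) ≡ + sumℕ m f - + 2 * + sumℕ m k
sumℤ-counts m f k = begin
  sumℤ m (λ e → + f e - + 2 * + k e)
    ≡⟨ sumℤ-- m _ _ ⟩
  sumℤ m (λ e → + f e) - sumℤ m (λ e → + 2 * + k e)
    ≡⟨ cong (sumℤ m (λ e → + f e) -_) (sumℤ-*ˡ m (+ 2) _) ⟩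
  sumℤ m (λ e → + f e) - + 2 * sumℤ m (λ e → + k e)
    ≡⟨ sym (cong₂ (λ x y → x - + 2 * y) (+-sumℕ m f) (+-sumℕ m k)) ⟩
  + sumℕ m f - + 2 * + sumℕ m k ∎

uninhabited↔Fin0 : {A : Set} → (A → ⊥) → A ↔ Fin 0
uninhabited↔Fin0 ¬a = mk↔ₛ′ (λ a → ⊥-elim (¬a a)) (λ ()) (λ ()) (λ a → ⊥-elim (¬a a))

Σ-split : ∀ {m} (B : Fin (suc m) → Set) →
  Σ (Fin (suc m)) B ↔ (B 0F ⊎ Σ (Fin m) (λ e → B (Fin.suc e)))
Σ-split B = mk↔ₛ′ to from to∘from from∘to
  where
  to : Σ _ B → _
  to (0F , b)        = inj₁ b
  to (Fin.suc e , b) = inj₂ (e , b)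
  from : _ → Σ _ B
  from (inj₁ b)       = 0F , b
  from (inj₂ (e , b)) = Fin.suc e , b
  to∘from : ∀ x → to (from x) ≡ x
  to∘from (inj₁ _) = refl
  to∘from (inj₂ _) = refl
  from∘to : ∀ x → from (to x) ≡ x
  from∘to (0F , _)       = refl
  from∘to (Fin.suc _ , _) = refl

Σ-count : ∀ m (B : Fin m → Set) (f : Fin m → ℕ) →
  (∀ e → B e ↔ Fin (f e)) → Σ (Fin m) B ↔ Fin (sumℕ m f)
Σ-count zero    B f B↔f = uninhabited↔Fin0 λ { (() , _) }
Σ-count (suc m) B f B↔f =
  ↔-trans (Σ-split B)
    (↔-trans (B↔f 0F ⊎-↔ Σ-count m _ _ (λ e → B↔f (Fin.suc e)))
             (↔-sym (+↔⊎ {f 0F})))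

-- At an edge e, a pair of vertices is described by d = [v = w], the
-- multiplicities a = ι(v,e), b = ι(w,e) and the sign functions s, t of the
-- incidences of v and w at e.

edgeSign : Bool → Maybe Sign → Maybe Sign → ℤ
edgeSign false (just s) (just t) = opposite (s Sign.* t) ◃ 1
edgeSign _     _        _        = + 0

sgn-local : (G : OHG) (e : Fin (nE G)) (v w : Fin (nV G)) →
  sgn G e v w ≡ edgeSign ⌊ v ≟ w ⌋ (firstSign (ι G v e) (σ G v e)) (firstSign (ι G w e) (σ G w e))
sgn-local G e v w with ⌊ v ≟ w ⌋ | firstSign (ι G v e) (σ G v e) | firstSign (ι G w e) (σ G w e)
... | false | just _  | just _  = refl
... | false | just _  | nothing = refl
... | false | nothing | _       = refl
... | true  | _       | _       = refl

localLaplacian : (d : Bool) (a b : ℕ) → (Fin a → Sign) → (Fin b → Sign) → ℤ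
localLaplacian d a b s t = (if d then + a else + 0) - edgeSign d (firstSign a s) (firstSign b t)

-- Pairs of incidences (k₁ of v, k₂ of w) at one edge, distinct as incidences,
-- whose one-step walk v, k₁, e, k₂, w is positive (its sign as in walkSign).
PositiveStep : (d : Bool) (a b : ℕ) → (Fin a → Sign) → (Fin b → Sign) → Set
PositiveStep d a b s t = Σ (Fin a) λ k₁ → Σ (Fin b) λ k₂ →
  T (not (d ∧ (toℕ k₁ ℕ.≡ᵇ toℕ k₂))) × (opposite (s k₁ Sign.* t k₂) Sign.* Sign.+ ≡ Sign.+)

positiveIndicator : Sign → ℕ
positiveIndicator Sign.+ = 1
positiveIndicator Sign.- = 0

-- The number of positive steps when a, b ≤ 1: none if v = w (the only
-- incidences coincide) or if an incidence is missing; otherwise one exactly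
-- when the step is positive.
positiveCount : (d : Bool) (a b : ℕ) → (Fin a → Sign) → (Fin b → Sign) → ℕ
positiveCount d 1 1 s t = if d then 0 else positiveIndicator (opposite (s 0F Sign.* t 0F) Sign.* Sign.+)
positiveCount _ _ _ _ _ = 0

positiveIndicator-↔ : ∀ x → (x ≡ Sign.+) ↔ Fin (positiveIndicator x)
positiveIndicator-↔ Sign.+ =
  mk↔ₛ′ (λ _ → 0F) (λ _ → refl) (λ { 0F → refl ; (Fin.suc ()) }) (λ { refl → refl })
positiveIndicator-↔ Sign.- = uninhabited↔Fin0 λ ()

singlePositiveStep-↔ : (s t : Fin 1 → Sign) →
  PositiveStep false 1 1 s t ↔ (opposite (s 0F Sign.* t 0F) Sign.* Sign.+ ≡ Sign.+)
singlePositiveStep-↔ s t =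
  mk↔ₛ′ (λ { (0F , 0F , _ , p) → p }) (λ p → 0F , 0F , tt , p)
        (λ _ → refl) (λ { (0F , 0F , tt , _) → refl })

PositiveStep-↔ : ∀ d a b s t → a ≤ 1 → b ≤ 1 → PositiveStep d a b s t ↔ Fin (positiveCount d a b s t)
PositiveStep-↔ d     .0 b  s t z≤n       _         = uninhabited↔Fin0 λ { (() , _) }
PositiveStep-↔ d     .1 .0 s t (s≤s z≤n) z≤n       = uninhabited↔Fin0 λ { (_ , () , _) }
PositiveStep-↔ true  .1 .1 s t (s≤s z≤n) (s≤s z≤n) = uninhabited↔Fin0 λ { (0F , 0F , () , _) }
PositiveStep-↔ false .1 .1 s t (s≤s z≤n) (s≤s z≤n) =
  ↔-trans (singlePositiveStep-↔ s t) (positiveIndicator-↔ _)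

unitStep : ∀ x → + 0 - (x ◃ 1) ≡ + 1 - + 2 * + positiveIndicator (x Sign.* Sign.+)
unitStep Sign.+ = refl
unitStep Sign.- = refl

-- Per-edge identity for v = w: the edge contributes ι(v,e) = ι(v,e)² and
-- admits no positive step.
loop-contribution : ∀ a s → a ≤ 1 →
  localLaplacian true a a s s ≡ + (a ℕ.* a) - + 2 * + positiveCount true a a s s
loop-contribution .0 s z≤n       = refl
loop-contribution .1 s (s≤s z≤n) = refl

link-contribution : ∀ a b s t → a ≤ 1 → b ≤ 1 →
  localLaplacian false a b s t ≡ + (a ℕ.* b) - + 2 * + positiveCount false a b s t
link-contribution .0 b  s t z≤n       _         = refl
link-contribution .1 .0 s t (s≤s z≤n) z≤n       = refl
link-contribution .1 .1 s t (s≤s z≤n) (s≤s z≤n) = unitStep (opposite (s 0F Sign.* t 0F))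

edgeLaplacian : (G : OHG) (v w : Fin (nV G)) → Fin (nE G) → ℤ
edgeLaplacian G v w e = localLaplacian ⌊ v ≟ w ⌋ (ι G v e) (ι G w e) (σ G v e) (σ G w e)

positiveSteps : (G : OHG) (v w : Fin (nV G)) → Fin (nE G) → ℕ
positiveSteps G v w e = positiveCount ⌊ v ≟ w ⌋ (ι G v e) (ι G w e) (σ G v e) (σ G w e)

laplacian-edgeSum : (G : OHG) (v w : Fin (nV G)) →
  laplacian G v w ≡ sumℤ (nE G) (edgeLaplacian G v w)
laplacian-edgeSum G v w = begin
  degreeMatrix G v w - adjacency G v w
    ≡⟨ cong₂ _-_ (if-sumℕ ⌊ v ≟ w ⌋ (nE G) (λ e → ι G v e)) (sumℤ-cong (nE G) (λ e → sgn-local G e v w)) ⟩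
  sumℤ (nE G) diagonal - sumℤ (nE G) offDiagonal
    ≡⟨ sym (sumℤ-- (nE G) diagonal offDiagonal) ⟩
  sumℤ (nE G) (edgeLaplacian G v w) ∎
  where
  diagonal offDiagonal : Fin (nE G) → ℤ
  diagonal e    = if ⌊ v ≟ w ⌋ then + ι G v e else + 0
  offDiagonal e = edgeSign ⌊ v ≟ w ⌋ (firstSign (ι G v e) (σ G v e)) (firstSign (ι G w e) (σ G w e))

edgeLaplacian-simple : (G : OHG) → Simple G → (v w : Fin (nV G)) (e : Fin (nE G)) →
  edgeLaplacian G v w e ≡ + (ι G v e ℕ.* ι G w e) - + 2 * + positiveSteps G v w e
edgeLaplacian-simple G simple v w e with v ≟ w
... | yes refl = loop-contribution _ (σ G v e) (simple v e)
... | no _     = link-contribution _ _ (σ G v e) (σ G w e) (simple v e) (simple w e)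

-- w̃(v,w;1) = Σ_e ι(v,e) ι(w,e): a weak walk of length 1 is an edge with an
-- incidence of each endpoint.
weakWalk₁-↔ : (G : OHG) (v w : Fin (nV G)) →
  WeakWalk G v w 1 ↔ Fin (sumℕ (nE G) (λ e → ι G v e ℕ.* ι G w e))
weakWalk₁-↔ G v w =
  ↔-trans asTriple (Σ-count (nE G) _ _ (λ e → ↔-sym (*↔× {ι G v e} {ι G w e})))
  where
  asTriple : WeakWalk G v w 1 ↔ Σ (Fin (nE G)) (λ e → Fin (ι G v e) × Fin (ι G w e))
  asTriple = mk↔ₛ′ (λ { (step e k₁ k₂ nil) → e , k₁ , k₂ }) (λ { (e , k₁ , k₂) → step e k₁ k₂ nil })
                   (λ _ → refl) (λ { (step _ _ _ nil) → refl })

-- w⁺(v,w;1) = Σ_e p_e(v,w) in a simple hypergraph: a positive walk of length 1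
-- is an edge with a positive step through it.
posWalk₁-↔ : (G : OHG) → Simple G → (v w : Fin (nV G)) →
  PosWalk G v w 1 ↔ Fin (sumℕ (nE G) (positiveSteps G v w))
posWalk₁-↔ G simple v w =
  ↔-trans asStep (Σ-count (nE G) _ _ (λ e → PositiveStep-↔ _ _ _ (σ G v e) (σ G w e) (simple v e) (simple w e)))
  where
  asStep : PosWalk G v w 1 ↔
    Σ (Fin (nE G)) (λ e → PositiveStep ⌊ v ≟ w ⌋ (ι G v e) (ι G w e) (σ G v e) (σ G w e))
  asStep = mk↔ₛ′ (λ { (step e k₁ k₂ p nil , q) → e , k₁ , k₂ , p , q })
                 (λ { (e , k₁ , k₂ , p , q) → step e k₁ k₂ p nil , q })
                 (λ _ → refl) (λ { (step _ _ _ _ nil , _) → refl })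

theorem5p6 : (G : OHG) → Simple G → (i j : Fin (nV G)) → (c₁ c₂ : ℕ) →
    (WeakWalk G i j 1 ↔ Fin c₁) → (PosWalk G i j 1 ↔ Fin c₂) →
    laplacian G i j ≡ + c₁ - + 2 * + c₂
theorem5p6 G simple i j c₁ c₂ weak↔c₁ pos↔c₂ = begin
  laplacian G i j
    ≡⟨ laplacian-edgeSum G i j ⟩
  sumℤ (nE G) (edgeLaplacian G i j)
    ≡⟨ sumℤ-cong (nE G) (edgeLaplacian-simple G simple i j) ⟩
  sumℤ (nE G) (λ e → + weakSteps e - + 2 * + positiveSteps G i j e)
    ≡⟨ sumℤ-counts (nE G) weakSteps (positiveSteps G i j) ⟩
  + sumℕ (nE G) weakSteps - + 2 * + sumℕ (nE G) (positiveSteps G i j)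
    ≡⟨ cong₂ (λ x y → + x - + 2 * + y) weakCount≡c₁ positiveCount≡c₂ ⟩
  + c₁ - + 2 * + c₂ ∎
  where
  weakSteps : Fin (nE G) → ℕ
  weakSteps e = ι G i e ℕ.* ι G j e
  weakCount≡c₁ : sumℕ (nE G) weakSteps ≡ c₁
  weakCount≡c₁ = ↔⇒≡ (↔-trans (↔-sym (weakWalk₁-↔ G i j)) weak↔c₁)
  positiveCount≡c₂ : sumℕ (nE G) (positiveSteps G i j) ≡ c₂
  positiveCount≡c₂ = ↔⇒≡ (↔-trans (↔-sym (posWalk₁-↔ G simple i j)) pos↔c₂)
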